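{- Let $t$ be a positive integer and let $M$ be a $t$-spike of order $r$. Then $r\ge 2t-1$.
   Context: For a matroid $M$, a $t$-echidna of order $n$ is a partition $(S_1,\dots,S_n)$ of a subset of $E(M)$ with $|S_i|=2$ for all $i$ such that $\bigcup_{i\in I}S_i$ is a circuit of $M$ for every $t$-element $I\subseteq\{1,\dots,n\}$; a $t$-coechidna of $M$ is a $t$-echidna of $M^*$. A matroid $M$ is a $t$-spike of order $r$ if there is a partition $(A_1,\dots,A_r)$ of $E(M)$ (the associated partition; the $A_i$ are arms) that is both a $t$-echidna and a $t$-coechidna of $M$, for some $r\ge t$. Thus each $A_i$ has size 2 and the union of any $t$ arms is both a circuit and a cocircuit. -}

module Defs where

open import Data.Nat using (ℕ; zero; suc; _<_)
open import Data.Fin using (Fin; zero; suc)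
open import Data.Fin.Subset using (Subset; _∈_; _∉_; _⊆_; _⊂_; _∪_; ⁅_⁆; ∁; ∣_∣; ⊥)
open import Data.Vec using (_∷_; [])
open import Data.Bool using (true; false)
open import Data.Product using (Σ; ∃; _×_)
open import Relation.Nullary using (¬_)
open import Relation.Binary.PropositionalEquality using (_≡_; _≢_)

record Matroid (m : ℕ) : Set₁ where
  field
    Indep      : Subset m → Set
    indep-⊥    : Indep ⊥
    indep-⊆    : ∀ {X Y} → X ⊆ Y → Indep Y → Indep X
    indep-aug  : ∀ {X Y} → Indep X → Indep Y → ∣ X ∣ < ∣ Y ∣ →
                 ∃ λ e → e ∈ Y × e ∉ X × Indep (X ∪ ⁅ e ⁆)

module _ {m : ℕ} (M : Matroid m) where
  open Matroid M

  IsBasis : Subset m → Set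
  IsBasis B = Indep B × (∀ X → Indep X → B ⊆ X → X ⊆ B)

  IsCircuit : Subset m → Set
  IsCircuit C = ¬ Indep C × (∀ Y → Y ⊂ C → Indep Y)

  CoIndep : Subset m → Set
  CoIndep X = ∃ λ B → IsBasis B × X ⊆ ∁ B

  IsCocircuit : Subset m → Set
  IsCocircuit C = ¬ CoIndep C × (∀ Y → Y ⊂ C → CoIndep Y)

⋃[_]_ : ∀ {r m} → Subset r → (Fin r → Subset m) → Subset m
⋃[_]_ {zero}  []            A = ⊥
⋃[_]_ {suc r} (true  ∷ I) A = A zero ∪ (⋃[ I ] (λ i → A (suc i)))
⋃[_]_ {suc r} (false ∷ I) A = ⋃[ I ] (λ i → A (suc i))

IsPairPartition : ∀ {m r} → (Fin r → Subset m) → Set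
IsPairPartition {m} {r} A =
  (∀ i → ∣ A i ∣ ≡ 2) ×
  (∀ i j → i ≢ j → ∀ e → e ∈ A i → e ∉ A j) ×
  (∀ (e : Fin m) → ∃ λ i → e ∈ A i)

IsSpike : ∀ {m} → ℕ → (r : ℕ) → Matroid m → Set
IsSpike {m} t r M =
  (t Data.Nat.≤ r) ×
  (Σ (Fin r → Subset m) λ A →
     IsPairPartition A ×
     (∀ (I : Subset r) → ∣ I ∣ ≡ t → IsCircuit M (⋃[ I ] A) × IsCocircuit M (⋃[ I ] A)))

module Submission where

-- Take any t arms; their union C has 2t elements
-- and is both a circuit and a cocircuit.  Deleting one element e of C leaves
-- a set C − e of size 2t − 1 that is independent (a proper subset of a
-- circuit) and coindependent (a proper subset of a cocircuit), hence lies in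
-- the complement of some basis B.  Every independent set has at most |B|
-- elements and C − e avoids B, so 2(2t − 1) ≤ |B| + |E − B| = |E| = 2r.

open import Defs
open import Data.Nat using (ℕ; _≤_; _*_; _∸_)
open import Data.Nat using (zero; suc; _+_; z≤n; s≤s; _<?_)
open import Data.Nat.Properties
  using (≤-refl; ≤-trans; ≤-antisym; ≤-reflexive; ≮⇒≥; +-suc; +-identityʳ; +-mono-≤;
         *-suc; *-zeroʳ; *-monoʳ-≤; *-cancelˡ-≤; m≤m+n; m+[n∸m]≡n; ∸-monoˡ-≤; module ≤-Reasoning)
open import Data.Fin using (Fin; zero; suc)
open import Data.Fin.Properties using (suc-injective; _≟_)
open import Data.Fin.Subset
open import Data.Fin.Subset.Properties
open import Data.Vec using (_∷_; []; here; there)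
open import Data.Bool using (true; false)
open import Data.Product using (Σ; ∃; _×_; _,_; proj₁; proj₂)
open import Data.Sum using (inj₁; inj₂)
open import Data.Empty using (⊥-elim)
open import Relation.Nullary using (yes; no)
open import Relation.Binary.PropositionalEquality
  using (_≡_; _≢_; refl; sym; trans; cong; cong₂; subst; module ≡-Reasoning)

private
  variable
    n : ℕ

∣p∪q∣+∣p∩q∣≡∣p∣+∣q∣ : (p q : Subset n) → ∣ p ∪ q ∣ + ∣ p ∩ q ∣ ≡ ∣ p ∣ + ∣ q ∣
∣p∪q∣+∣p∩q∣≡∣p∣+∣q∣ []          []          = refl
∣p∪q∣+∣p∩q∣≡∣p∣+∣q∣ (true ∷ p)  (true ∷ q)  = cong suc (begin
  ∣ p ∪ q ∣ + suc ∣ p ∩ q ∣ ≡⟨ +-suc ∣ p ∪ q ∣ ∣ p ∩ q ∣ ⟩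
  suc (∣ p ∪ q ∣ + ∣ p ∩ q ∣) ≡⟨ cong suc (∣p∪q∣+∣p∩q∣≡∣p∣+∣q∣ p q) ⟩
  suc (∣ p ∣ + ∣ q ∣)         ≡⟨ sym (+-suc ∣ p ∣ ∣ q ∣) ⟩
  ∣ p ∣ + suc ∣ q ∣           ∎)
  where open ≡-Reasoning
∣p∪q∣+∣p∩q∣≡∣p∣+∣q∣ (true ∷ p)  (false ∷ q) = cong suc (∣p∪q∣+∣p∩q∣≡∣p∣+∣q∣ p q)
∣p∪q∣+∣p∩q∣≡∣p∣+∣q∣ (false ∷ p) (true ∷ q)  = begin
  suc (∣ p ∪ q ∣ + ∣ p ∩ q ∣) ≡⟨ cong suc (∣p∪q∣+∣p∩q∣≡∣p∣+∣q∣ p q) ⟩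
  suc (∣ p ∣ + ∣ q ∣)         ≡⟨ sym (+-suc ∣ p ∣ ∣ q ∣) ⟩
  ∣ p ∣ + suc ∣ q ∣           ∎
  where open ≡-Reasoning
∣p∪q∣+∣p∩q∣≡∣p∣+∣q∣ (false ∷ p) (false ∷ q) = ∣p∪q∣+∣p∩q∣≡∣p∣+∣q∣ p q

∣p∪q∣≤∣p∣+∣q∣ : (p q : Subset n) → ∣ p ∪ q ∣ ≤ ∣ p ∣ + ∣ q ∣
∣p∪q∣≤∣p∣+∣q∣ p q =
  ≤-trans (m≤m+n ∣ p ∪ q ∣ ∣ p ∩ q ∣) (≤-reflexive (∣p∪q∣+∣p∩q∣≡∣p∣+∣q∣ p q))

disjoint⇒∣p∪q∣≡∣p∣+∣q∣ : (p q : Subset n) → Empty (p ∩ q) → ∣ p ∪ q ∣ ≡ ∣ p ∣ + ∣ q ∣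
disjoint⇒∣p∪q∣≡∣p∣+∣q∣ {n} p q p∩q-empty = begin
  ∣ p ∪ q ∣             ≡⟨ sym (+-identityʳ ∣ p ∪ q ∣) ⟩
  ∣ p ∪ q ∣ + 0         ≡⟨ cong (∣ p ∪ q ∣ +_) (sym (∣⊥∣≡0 n)) ⟩
  ∣ p ∪ q ∣ + ∣ ⊥ {n} ∣ ≡⟨ cong (λ s → ∣ p ∪ q ∣ + ∣ s ∣) (sym (Empty-unique p∩q-empty)) ⟩
  ∣ p ∪ q ∣ + ∣ p ∩ q ∣ ≡⟨ ∣p∪q∣+∣p∩q∣≡∣p∣+∣q∣ p q ⟩
  ∣ p ∣ + ∣ q ∣         ∎
  where open ≡-Reasoning

∣p∣≤1+∣p-x∣ : {p : Subset n} {x : Fin n} → x ∈ p → ∣ p ∣ ≤ suc ∣ p - x ∣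
∣p∣≤1+∣p-x∣ {p = p} {x} x∈p = begin
  ∣ p ∣                     ≤⟨ p⊆q⇒∣p∣≤∣q∣ p⊆⁅x⁆∪p-x ⟩
  ∣ ⁅ x ⁆ ∪ (p - x) ∣       ≤⟨ ∣p∪q∣≤∣p∣+∣q∣ ⁅ x ⁆ (p - x) ⟩
  ∣ ⁅ x ⁆ ∣ + ∣ p - x ∣     ≡⟨ cong (_+ ∣ p - x ∣) (∣⁅x⁆∣≡1 x) ⟩
  suc ∣ p - x ∣             ∎
  where
  open ≤-Reasoning
  p⊆⁅x⁆∪p-x : p ⊆ ⁅ x ⁆ ∪ (p - x)
  p⊆⁅x⁆∪p-x {y} y∈p with y ≟ x
  ... | yes refl = x∈p∪q⁺ (inj₁ (x∈⁅x⁆ x))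
  ... | no y≢x   = x∈p∪q⁺ (inj₂ (x∈p∧x≢y⇒x∈p-y y∈p y≢x))

subset-of-size : ∀ r t → t ≤ r → Σ (Subset r) λ I → ∣ I ∣ ≡ t
subset-of-size zero    zero    z≤n     = [] , refl
subset-of-size (suc r) zero    z≤n     with subset-of-size r zero z≤n
... | I , ∣I∣≡0 = false ∷ I , ∣I∣≡0
subset-of-size (suc r) (suc t) (s≤s t≤r) with subset-of-size r t t≤r
... | I , ∣I∣≡t = true ∷ I , cong suc ∣I∣≡t

∈⋃⁻ : ∀ {r m} (I : Subset r) (A : Fin r → Subset m) {e : Fin m} →
      e ∈ ⋃[ I ] A → ∃ λ i → i ∈ I × e ∈ A i
∈⋃⁻ [] A e∈⋃ = ⊥-elim (∉⊥ e∈⋃)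
∈⋃⁻ (true ∷ I) A e∈⋃ with x∈p∪q⁻ (A zero) (⋃[ I ] (λ i → A (suc i))) e∈⋃
... | inj₁ e∈A₀ = zero , here , e∈A₀
... | inj₂ e∈⋃' with ∈⋃⁻ I (λ i → A (suc i)) e∈⋃'
...   | i , i∈I , e∈Aᵢ = suc i , there i∈I , e∈Aᵢ
∈⋃⁻ (false ∷ I) A e∈⋃ with ∈⋃⁻ I (λ i → A (suc i)) e∈⋃
... | i , i∈I , e∈Aᵢ = suc i , there i∈I , e∈Aᵢ

∈⋃⁺ : ∀ {r m} (I : Subset r) (A : Fin r → Subset m) {e : Fin m} (i : Fin r) →
      i ∈ I → e ∈ A i → e ∈ ⋃[ I ] A
∈⋃⁺ (true ∷ I)  A zero    here        e∈A₀ = x∈p∪q⁺ (inj₁ e∈A₀)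
∈⋃⁺ (true ∷ I)  A (suc i) (there i∈I) e∈Aᵢ = x∈p∪q⁺ (inj₂ (∈⋃⁺ I (λ j → A (suc j)) i i∈I e∈Aᵢ))
∈⋃⁺ (false ∷ I) A (suc i) (there i∈I) e∈Aᵢ = ∈⋃⁺ I (λ j → A (suc j)) i i∈I e∈Aᵢ

PairwiseDisjoint : ∀ {r m} → (Fin r → Subset m) → Set
PairwiseDisjoint A = ∀ i j → i ≢ j → ∀ e → e ∈ A i → e ∉ A j

disjoint-tail : ∀ {r m} {A : Fin (suc r) → Subset m} →
                PairwiseDisjoint A → PairwiseDisjoint (λ i → A (suc i))
disjoint-tail disjoint i j i≢j = disjoint (suc i) (suc j) (λ eq → i≢j (suc-injective eq))

∣⋃∣≡k*∣I∣ : ∀ {r m k} (I : Subset r) (A : Fin r → Subset m) →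
            (∀ i → ∣ A i ∣ ≡ k) → PairwiseDisjoint A → ∣ ⋃[ I ] A ∣ ≡ k * ∣ I ∣
∣⋃∣≡k*∣I∣ {m = m} {k} [] A sizes disjoint = trans (∣⊥∣≡0 m) (sym (*-zeroʳ k))
∣⋃∣≡k*∣I∣ {r = suc r} {m} {k} (true ∷ I) A sizes disjoint = begin
  ∣ A zero ∪ ⋃[ I ] A′ ∣          ≡⟨ disjoint⇒∣p∪q∣≡∣p∣+∣q∣ (A zero) (⋃[ I ] A′) A₀∩⋃-empty ⟩
  ∣ A zero ∣ + ∣ ⋃[ I ] A′ ∣      ≡⟨ cong₂ _+_ (sizes zero) (∣⋃∣≡k*∣I∣ I A′ (λ i → sizes (suc i)) (disjoint-tail disjoint)) ⟩
  k + k * ∣ I ∣                  ≡⟨ sym (*-suc k ∣ I ∣) ⟩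
  k * suc ∣ I ∣                  ∎
  where
  open ≡-Reasoning
  A′ : Fin r → Subset m
  A′ i = A (suc i)
  A₀∩⋃-empty : Empty (A zero ∩ ⋃[ I ] A′)
  A₀∩⋃-empty (e , e∈∩) with x∈p∩q⁻ (A zero) (⋃[ I ] A′) e∈∩
  ... | e∈A₀ , e∈⋃ with ∈⋃⁻ I A′ e∈⋃
  ...   | i , _ , e∈Aᵢ = disjoint zero (suc i) (λ ()) e e∈A₀ e∈Aᵢ
∣⋃∣≡k*∣I∣ (false ∷ I) A sizes disjoint =
  ∣⋃∣≡k*∣I∣ I (λ i → A (suc i)) (λ i → sizes (suc i)) (disjoint-tail disjoint)

∣E∣≡2r : ∀ {m r} (A : Fin r → Subset m) → IsPairPartition A → m ≡ 2 * r
∣E∣≡2r {m} {r} A (sizes , disjoint , covered) = begin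
  m               ≡⟨ ≤-antisym m≤∣⋃∣ (∣p∣≤n (⋃[ ⊤ ] A)) ⟩
  ∣ ⋃[ ⊤ ] A ∣    ≡⟨ ∣⋃∣≡k*∣I∣ ⊤ A sizes disjoint ⟩
  2 * ∣ ⊤ {r} ∣   ≡⟨ cong (2 *_) (∣⊤∣≡n r) ⟩
  2 * r           ∎
  where
  open ≡-Reasoning
  ⊤⊆⋃ : ⊤ ⊆ ⋃[ ⊤ ] A
  ⊤⊆⋃ {e} _ = ∈⋃⁺ ⊤ A (proj₁ (covered e)) ∈⊤ (proj₂ (covered e))
  m≤∣⋃∣ : m ≤ ∣ ⋃[ ⊤ ] A ∣
  m≤∣⋃∣ = ≤-trans (≤-reflexive (sym (∣⊤∣≡n m))) (p⊆q⇒∣p∣≤∣q∣ ⊤⊆⋃)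

module _ {m : ℕ} (M : Matroid m) where
  open Matroid M

  -- By augmentation, no independent set is larger than a basis.
  indep≤basis : ∀ {X B} → Indep X → IsBasis M B → ∣ X ∣ ≤ ∣ B ∣
  indep≤basis {X} {B} X-indep (B-indep , B-maximal) with ∣ B ∣ <? ∣ X ∣
  ... | no  B≮X = ≮⇒≥ B≮X
  ... | yes B<X with indep-aug B-indep X-indep B<X
  ...   | e , _ , e∉B , B+e-indep =
    ⊥-elim (e∉B (B-maximal (B ∪ ⁅ e ⁆) B+e-indep (p⊆p∪q ⁅ e ⁆) (x∈p∪q⁺ (inj₂ (x∈⁅x⁆ e)))))

  -- A set independent in both M and M* avoids a basis B while being no larger
  -- than B, so it has at most half of the elements.
  indep∧coindep⇒2∣X∣≤m : ∀ {X} → Indep X → CoIndep M X → 2 * ∣ X ∣ ≤ m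
  indep∧coindep⇒2∣X∣≤m {X} X-indep (B , B-basis , X⊆∁B) = begin
    ∣ X ∣ + (∣ X ∣ + 0)         ≤⟨ +-mono-≤ (indep≤basis X-indep B-basis) (+-mono-≤ ∣X∣≤m∸∣B∣ ≤-refl) ⟩
    ∣ B ∣ + ((m ∸ ∣ B ∣) + 0)   ≡⟨ cong (∣ B ∣ +_) (+-identityʳ (m ∸ ∣ B ∣)) ⟩
    ∣ B ∣ + (m ∸ ∣ B ∣)         ≡⟨ m+[n∸m]≡n (∣p∣≤n B) ⟩
    m                           ∎
    where
    open ≤-Reasoning
    ∣X∣≤m∸∣B∣ : ∣ X ∣ ≤ m ∸ ∣ B ∣
    ∣X∣≤m∸∣B∣ = ≤-trans (p⊆q⇒∣p∣≤∣q∣ X⊆∁B) (≤-reflexive (∣∁p∣≡n∸∣p∣ B))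

  -- Circuits are nonempty, because the empty set is independent.
  circuit-nonempty : ∀ {C} → IsCircuit M C → Nonempty C
  circuit-nonempty {C} (C-dependent , _) with nonempty? C
  ... | yes C-nonempty = C-nonempty
  ... | no  C-empty    = ⊥-elim (C-dependent (subst Indep (sym (Empty-unique C-empty)) indep-⊥))

  -- If C is both a circuit and a cocircuit then, for any e ∈ C, the set C − e
  -- is independent and coindependent; hence 2(|C| − 1) ≤ |E(M)|.
  circuit∧cocircuit⇒2[∣C∣∸1]≤m : ∀ {C} → IsCircuit M C → IsCocircuit M C → 2 * (∣ C ∣ ∸ 1) ≤ m
  circuit∧cocircuit⇒2[∣C∣∸1]≤m {C} circuit cocircuit with circuit-nonempty circuit
  ... | e , e∈C = ≤-trans (*-monoʳ-≤ 2 (∸-monoˡ-≤ 1 (∣p∣≤1+∣p-x∣ e∈C)))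
                    (indep∧coindep⇒2∣X∣≤m (proj₂ circuit (C - e) C-e⊂C) (proj₂ cocircuit (C - e) C-e⊂C))
    where
    C-e⊂C : C - e ⊂ C
    C-e⊂C = x∈p⇒p-x⊂p e∈C

-- A t-spike of order r satisfies r ≥ 2t − 1: the union
-- C of any t arms has 2t elements and is a circuit and a cocircuit, so
-- 2(2t − 1) ≤ |E(M)| = 2r.  (Nonemptiness of circuits makes 1 ≤ t redundant.)
lemma6p1 : (t m r : ℕ) (M : Matroid m) → 1 ≤ t → IsSpike t r M → 2 * t ∸ 1 ≤ r
lemma6p1 t m r M _ (t≤r , A , partition@(sizes , disjoint , _) , t-arms-circuit∧cocircuit) =
  *-cancelˡ-≤ 2 (begin
    2 * (2 * t ∸ 1)    ≡⟨ cong (λ s → 2 * (s ∸ 1)) (sym ∣C∣≡2t) ⟩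
    2 * (∣ C ∣ ∸ 1)    ≤⟨ circuit∧cocircuit⇒2[∣C∣∸1]≤m M C-circuit C-cocircuit ⟩
    m                  ≡⟨ ∣E∣≡2r A partition ⟩
    2 * r              ∎)
  where
  open ≤-Reasoning
  I : Subset r
  I = proj₁ (subset-of-size r t t≤r)
  ∣I∣≡t : ∣ I ∣ ≡ t
  ∣I∣≡t = proj₂ (subset-of-size r t t≤r)
  C : Subset m
  C = ⋃[ I ] A
  C-circuit : IsCircuit M C
  C-circuit = proj₁ (t-arms-circuit∧cocircuit I ∣I∣≡t)
  C-cocircuit : IsCocircuit M C
  C-cocircuit = proj₂ (t-arms-circuit∧cocircuit I ∣I∣≡t)
  ∣C∣≡2t : ∣ C ∣ ≡ 2 * t
  ∣C∣≡2t = trans (∣⋃∣≡k*∣I∣ I A sizes disjoint) (cong (2 *_) ∣I∣≡t)
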